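{- Let $k\ge2$, $q\ge1$, and let $\beta=(n_1^{m_1},n_2^{m_2},\ldots,n_t^{m_t})$ be a partition of $k$ into $s$ parts (the distinct parts are $n_1,\ldots,n_t$ with multiplicities $m_1,\ldots,m_t$, $m_1+\cdots+m_t=s$). Then the number of $(s-1)$-dimensional faces $G$ of $R_{k,q}$ whose associated partition $\lambda(G)$ equals $\beta$ (i.e. whose relative-interior vertices have link combinatorially equivalent to $K_\beta$) is $$\frac{k\cdot(s-1)!}{m_1!\,m_2!\cdots m_t!}.$$
   Context: $R_{k,q}=\{\mathbf{x}\in\mathbb{R}^{k-1}:0\le x_1\le\cdots\le x_{k-1}\le q\}$ is the $(k-1)$-simplex with vertices $\mathbf{w}_i=(0,\ldots,0,q,\ldots,q)$ ($k-i$ zeros followed by $i-1$ entries $q$), $i\in[k]$. Every $(s-1)$-dimensional face $G$ of $R_{k,q}$ is $\mathrm{conv}\{\mathbf{w}_{1+\alpha_s},\mathbf{w}_{1+\alpha_s+\alpha_{s-1}},\ldots,\mathbf{w}_{1+\alpha_s+\cdots+\alpha_1}\}$ for a unique tuple $(\alpha_0;\alpha_1,\ldots,\alpha_{s-1};\alpha_s)$ of integers with $\alpha_0,\alpha_s\ge0$, $\alpha_i\ge1$ for $0<i<s$, and $\alpha_0+\cdots+\alpha_s=k-1$ (this is the common "type" of the lattice points in the relative interior of $G$: $\alpha_0$ coordinates equal to $0$, $\alpha_s$ equal to $q$, and the remaining coordinates forming $s-1$ blocks of equal values of sizes $\alpha_1,\ldots,\alpha_{s-1}$). The associated partition $\lambda(G)$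 is the partition of $k$ into $s$ parts with parts $\alpha_0+\alpha_s+1,\alpha_1,\ldots,\alpha_{s-1}$. In the edgewise subdivision $T_{k,q}$ of $R_{k,q}$, every vertex in the relative interior of $G$ has link isomorphic to $K_{\lambda(G)}$, where for a partition $\lambda=(\lambda_1,\ldots,\lambda_s)$, $K_\lambda$ is the order complex of $C_{\lambda_1}\times\cdots\times C_{\lambda_s}$ with minimum and maximum removed ($C_m$ the chain $0<\cdots<m$), and distinct partitions give non-isomorphic $K_\lambda$. -}

module Defs where

open import Data.Bool using (Bool; true; false; if_then_else_)
open import Data.Nat using (ℕ; zero; suc; _+_; _*_; _∸_)
open import Data.Nat.Properties using (≤-decTotalOrder; _≟_)
open import Data.Nat using (_!)
open import Data.Nat.ListAction using (product; sum)
open import Data.List using (List; []; _∷_; [_]; _++_; map; length; filter; reverse; upTo; last)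
open import Data.List.Properties using (≡-dec)
open import Data.Maybe using (Maybe; just; nothing)
open import Data.Vec using (Vec; []; _∷_)
open import Data.Fin.Subset using (Subset; ∣_∣)
open import Data.Product using (_×_; _,_)
open import Relation.Nullary.Decidable using (_×-dec_)
open import Relation.Binary.PropositionalEquality using (_≡_)
import Data.List.Sort.InsertionSort as IS

open IS ≤-decTotalOrder using (sort) public

allSubsets : (n : ℕ) → List (Subset n)
allSubsets zero    = [] ∷ []
allSubsets (suc n) = map (true ∷_) (allSubsets n) ++ map (false ∷_) (allSubsets n)

indices : ∀ {n} → Subset n → List ℕ
indices []            = []
indices (true  ∷ p) = 1 ∷ map suc (indices p)
indices (false ∷ p) = map suc (indices p)

gaps : List ℕ → List ℕ
gaps (a ∷ b ∷ r) = (b ∸ a) ∷ gaps (b ∷ r)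
gaps _           = []

headOr0 : List ℕ → ℕ
headOr0 []      = 0
headOr0 (x ∷ _) = x

lastOr0 : List ℕ → ℕ
lastOr0 l with last l
... | just x  = x
... | nothing = 0

-- Faces of the (k-1)-simplex R_{k,q} = conv{w_1,…,w_k} are identified with
-- nonempty subsets of its vertex set; a face G has dimension s-1 iff it has
-- s vertices.  Writing G = conv{w_{i_1},…,w_{i_s}}, i_1<…<i_s, its type
-- (α_0; α_1,…,α_{s-1}; α_s) is determined by
--   i_1 = 1+α_s, i_{j+1} = i_j + α_{s-j}, and α_0 = k-1-(α_1+…+α_s) = k - i_s.
alpha0 : (k : ℕ) → Subset k → ℕ
alpha0 k G = k ∸ lastOr0 (indices G)

alphaS : ∀ {k} → Subset k → ℕ
alphaS G = headOr0 (indices G) ∸ 1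

alphaMid : ∀ {k} → Subset k → List ℕ
alphaMid G = reverse (gaps (indices G))

lam : (k : ℕ) → Subset k → List ℕ
lam k G = (alpha0 k G + alphaS G + 1) ∷ alphaMid G

-- Partitions are lists of parts; two are equal as partitions iff they are
-- equal as multisets, i.e. iff their sorted versions coincide.
-- number of (s-1)-dimensional faces G of R_{k,q} with λ(G) = β
numFaces : (k s : ℕ) → List ℕ → ℕ
numFaces k s β =
  length (filter (λ G → (∣ G ∣ ≟ s) ×-dec ≡-dec _≟_ (sort (lam k G)) (sort β))
                 (allSubsets k))

mult : ℕ → List ℕ → ℕ
mult v β = length (filter (v ≟_) β)

-- m_1! m_2! ⋯ m_t!  (values v that do not occur contribute 0! = 1;
-- every part of a partition of k lies in 1..k)
multFactorials : (k : ℕ) → List ℕ → ℕ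
multFactorials k β = product (map (λ v → (mult (suc v) β) !) (upTo k))

{-# OPTIONS --safe #-}
-- Read cyclically, the vertex indices of a face G with s vertices form an
-- s-subset I of ℤ/k, and λ(G) is the multiset of gaps between cyclically
-- consecutive elements of I.  Cutting the cycle at 0 splits the gap v across
-- 0 into i₁ ≥ 1 positions up to the first element and v − i₁ after the last
-- one; I is determined by i₁ and the sequence of its other s − 1 gaps.  A
-- multiset μ has |μ|! / ∏ᵤ (mult u μ)! rearrangements, and removing one copy
-- of v from β divides ∏ᵤ (mult u β)! by mult v β.  Hence, summing over the
-- distinct parts v of β,
--   #faces · ∏ᵢ mᵢ! = Σᵥ v · mult v β · (s − 1)! = (Σ β) (s − 1)! = k (s − 1)!.

module Submission where

open import Defs
open import Data.Nat using (ℕ; _*_; _∸_; _≤_)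
open import Data.Nat using (_!)
open import Data.Nat.ListAction using (sum)
open import Data.List using (List; length)
open import Data.List.Relation.Unary.All using (All)
open import Relation.Binary.PropositionalEquality using (_≡_)

open import Level using (Level)
open import Function using (_∘_)
open import Data.Bool using (true; false)
open import Data.Nat using (zero; suc; _+_; _<_; _≟_; _<?_; s≤s; z≤n)
open import Data.Nat.Properties
open import Data.Nat.ListAction using (product)
open import Data.Nat.ListAction.Properties using (sum-↭; product-++)
open import Data.Nat.Tactic.RingSolver using (solve-∀)
open import Data.Fin using (Fin; toℕ) renaming (zero to fzero; suc to fsuc)
open import Data.Fin.Subset using (Subset; ∣_∣)
open import Data.Vec using ([]; _∷_)
open import Data.Maybe using (just; nothing; fromMaybe)
open import Data.Product using (∃; _×_; _,_; proj₁; proj₂)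
open import Data.List using ([]; _∷_; [_]; _++_; _∷ʳ_; map; filter; reverse; last; upTo)
open import Data.List.Properties
  using (length-++; map-++; map-id; upTo-∷ʳ; ≡-dec;
         filter-++; filter-≐; filter-accept; filter-reject; filter-none; filter-all)
open import Data.List.Relation.Unary.All using ([]; _∷_; universal)
import Data.List.Relation.Unary.All as All
open import Data.List.Relation.Unary.All.Properties using (¬Any⇒All¬)
open import Data.List.Relation.Unary.Any using (here)
open import Data.List.Membership.Propositional using (_∈_; _∉_)
open import Data.List.Membership.Propositional.Properties using (∈-∃++)
open import Data.List.Membership.DecPropositional _≟_ using (_∈?_)
open import Data.List.Relation.Binary.Permutation.Propositional as ↭
  using (_↭_; ↭-sym; ↭-trans; ↭⇒↭ₛ)
open import Data.List.Relation.Binary.Permutation.Propositional.Properties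
  using (↭-length; ↭-reverse; ¬x∷xs↭[]; drop-∷; shift; filter-↭; ∈-resp-↭; All-resp-↭)
open import Data.List.Relation.Binary.Pointwise using (Pointwise-≡⇒≡)
open import Data.List.Relation.Unary.Sorted.TotalOrder.Properties using (↗↭↗⇒≋)
import Data.List.Sort.InsertionSort.Properties ≤-decTotalOrder as InsertionSort
open import Relation.Nullary using (Dec; yes; no; ¬_; does; contradiction; map′; _×-dec_)
open import Relation.Unary using (Pred; Decidable; _≐_; ∁)
open import Relation.Unary.Properties using (_∩?_)
open import Relation.Binary.PropositionalEquality
  using (refl; sym; trans; cong; cong₂; subst; module ≡-Reasoning)
open import Algebra.Properties.Semiring.Sum +-*-semiring
  using (sum-syntax; sum-cong-≗; sum-replicate-zero; *-distribʳ-sum)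
open import Algebra.Properties.CommutativeSemigroup *-commutativeSemigroup
  using () renaming (x∙yz≈y∙xz to *-exchange)
open import Algebra.Properties.CommutativeSemigroup +-commutativeSemigroup
  using () renaming (x∙yz≈y∙xz to +-exchange)

private
  variable
    a b p q : Level
    A : Set a
    B : Set b

count : {P : Pred A p} → Decidable P → List A → ℕ
count P? xs = length (filter P? xs)

module _ {P : Pred A p} (P? : Decidable P) where

  count-accept : ∀ {x xs} → P x → count P? (x ∷ xs) ≡ suc (count P? xs)
  count-accept px = cong length (filter-accept P? px)

  count-reject : ∀ {x xs} → ¬ P x → count P? (x ∷ xs) ≡ count P? xs
  count-reject ¬px = cong length (filter-reject P? ¬px)

  count-none : ∀ {xs} → All (∁ P) xs → count P? xs ≡ 0
  count-none h = cong length (filter-none P? h)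

  count-∅ : (∀ x → ¬ P x) → ∀ xs → count P? xs ≡ 0
  count-∅ ¬P xs = count-none (universal ¬P xs)

  count-all : ∀ {xs} → All P xs → count P? xs ≡ length xs
  count-all h = cong length (filter-all P? h)

  count-++ : ∀ xs ys → count P? (xs ++ ys) ≡ count P? xs + count P? ys
  count-++ xs ys = trans (cong length (filter-++ P? xs ys)) (length-++ (filter P? xs))

  count-map : (f : B → A) (xs : List B) → count P? (map f xs) ≡ count (P? ∘ f) xs
  count-map f []       = refl
  count-map f (x ∷ xs) with does (P? (f x))
  ... | true  = cong suc (count-map f xs)
  ... | false = count-map f xs

  count-↭ : ∀ {xs ys} → xs ↭ ys → count P? xs ≡ count P? ys
  count-↭ xs↭ys = ↭-length (filter-↭ P? xs↭ys)

count-≐ : {P : Pred A p} {Q : Pred A q} (P? : Decidable P) (Q? : Decidable Q) → P ≐ Q →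
          ∀ xs → count P? xs ≡ count Q? xs
count-≐ P? Q? P≐Q xs = cong length (filter-≐ P? Q? P≐Q xs)

count-allSubsets-suc : ∀ n {P : Pred (Subset (suc n)) p} (P? : Decidable P) →
  count P? (allSubsets (suc n)) ≡
  count (P? ∘ (true ∷_)) (allSubsets n) + count (P? ∘ (false ∷_)) (allSubsets n)
count-allSubsets-suc n P? = begin
  count P? (map (true ∷_) (allSubsets n) ++ map (false ∷_) (allSubsets n))
    ≡⟨ count-++ P? (map (true ∷_) (allSubsets n)) _ ⟩
  count P? (map (true ∷_) (allSubsets n)) + count P? (map (false ∷_) (allSubsets n))
    ≡⟨ cong₂ _+_ (count-map P? (true ∷_) (allSubsets n)) (count-map P? (false ∷_) (allSubsets n)) ⟩
  count (P? ∘ (true ∷_)) (allSubsets n) + count (P? ∘ (false ∷_)) (allSubsets n) ∎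
  where open ≡-Reasoning

∑-bump : ∀ {N} (g h : Fin N → ℕ) i → i < N →
  (∀ e → i ≡ toℕ e → g e ≡ suc (h e)) → (∀ e → ¬ i ≡ toℕ e → g e ≡ h e) →
  ∑[ e < N ] g e ≡ suc (∑[ e < N ] h e)
∑-bump {suc N} g h zero    _         hit miss =
  cong₂ _+_ (hit fzero refl) (sum-cong-≗ (λ e → miss (fsuc e) λ ()))
∑-bump {suc N} g h (suc i) (s≤s i<N) hit miss = begin
  g fzero + ∑[ e < N ] g (fsuc e)
    ≡⟨ cong₂ _+_ (miss fzero λ ()) (∑-bump (g ∘ fsuc) (h ∘ fsuc) i i<N
                   (λ e → hit (fsuc e) ∘ cong suc) (λ e i≢e → miss (fsuc e) (i≢e ∘ suc-injective))) ⟩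
  h fzero + suc (∑[ e < N ] h (fsuc e))
    ≡⟨ +-suc (h fzero) _ ⟩
  suc (∑[ e < suc N ] h e) ∎
  where open ≡-Reasoning

count-fibres : {P : Pred A p} (P? : Decidable P) (f : A → ℕ) {N : ℕ} → (∀ x → f x < N) →
  ∀ xs → count P? xs ≡ ∑[ e < N ] count (P? ∩? (λ x → f x ≟ toℕ e)) xs
count-fibres P? f {N} f<N [] = sym (sum-replicate-zero N)
count-fibres {P = P} P? f {N} f<N (x ∷ xs) = fibre (P? x)
  where
  fibre : Dec (P x) → count P? (x ∷ xs) ≡ ∑[ e < N ] count (P? ∩? (λ y → f y ≟ toℕ e)) (x ∷ xs)
  fibre (yes px) = trans (count-accept P? px) (trans (cong suc (count-fibres P? f f<N xs))
    (sym (∑-bump _ _ (f x) (f<N x) (λ e eq → count-accept (P? ∩? _) (px , eq))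
                                   (λ e ne → count-reject (P? ∩? _) (ne ∘ proj₂)))))
  fibre (no ¬px) = trans (count-reject P? ¬px) (trans (count-fibres P? f f<N xs)
    (sym (sum-cong-≗ {N} λ e → count-reject (P? ∩? (λ y → f y ≟ toℕ e)) {x} {xs} (¬px ∘ proj₁))))

sort-≡⇒↭ : ∀ {xs ys} → sort xs ≡ sort ys → xs ↭ ys
sort-≡⇒↭ {xs} {ys} eq =
  ↭-trans (↭-sym (InsertionSort.sort-↭ xs)) (subst (_↭ ys) (sym eq) (InsertionSort.sort-↭ ys))

↭⇒sort-≡ : ∀ {xs ys} → xs ↭ ys → sort xs ≡ sort ys
↭⇒sort-≡ {xs} {ys} xs↭ys = Pointwise-≡⇒≡ (↗↭↗⇒≋ ≤-totalOrder
  (InsertionSort.sort-↗ xs) (InsertionSort.sort-↗ ys)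
  (↭⇒↭ₛ (↭-trans (InsertionSort.sort-↭ xs) (↭-trans xs↭ys (↭-sym (InsertionSort.sort-↭ ys))))))

infix 4 _↭?_
opaque
  _↭?_ : (xs ys : List ℕ) → Dec (xs ↭ ys)
  xs ↭? ys = map′ sort-≡⇒↭ ↭⇒sort-≡ (≡-dec _≟_ (sort xs) (sort ys))

∈⇒↭∷ : ∀ {v : A} {xs} → v ∈ xs → ∃ λ ys → xs ↭ v ∷ ys
∈⇒↭∷ {v = v} v∈xs with ys , zs , refl ← ∈-∃++ v∈xs = ys ++ zs , shift v ys zs

mult-∉ : ∀ {v xs} → v ∉ xs → mult v xs ≡ 0
mult-∉ {v} {xs} v∉xs = count-none (v ≟_) (¬Any⇒All¬ xs v∉xs)

mult-self : ∀ v xs → mult v (v ∷ xs) ≡ suc (mult v xs)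
mult-self v xs = count-accept (v ≟_) refl

-- The factor contributed by an entry is its number of occurrences from that
-- entry on, so ∏mult! xs = ∏ᵤ (mult u xs)!.
∏mult! : List ℕ → ℕ
∏mult! []       = 1
∏mult! (x ∷ xs) = suc (mult x xs) * ∏mult! xs

∏mult!-↭ : ∀ {xs ys} → xs ↭ ys → ∏mult! xs ≡ ∏mult! ys
∏mult!-↭ ↭.refl           = refl
∏mult!-↭ (↭.prep x xs↭ys) = cong₂ (λ m r → suc m * r) (count-↭ (x ≟_) xs↭ys) (∏mult!-↭ xs↭ys)
∏mult!-↭ (↭.trans p q)    = trans (∏mult!-↭ p) (∏mult!-↭ q)
∏mult!-↭ {x ∷ y ∷ xs} {y ∷ x ∷ ys} (↭.swap x y xs↭ys) with x ≟ y
... | yes refl = cong₂ (λ m r → suc m * r) (count-↭ (x ≟_) (↭.prep x xs↭ys))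
                   (cong₂ (λ m r → suc m * r) (count-↭ (x ≟_) xs↭ys) (∏mult!-↭ xs↭ys))
... | no x≢y = begin
  suc (mult x (y ∷ xs)) * (suc (mult y xs) * ∏mult! xs)
    ≡⟨ cong (λ m → suc m * (suc (mult y xs) * ∏mult! xs)) (count-reject (x ≟_) x≢y) ⟩
  suc (mult x xs) * (suc (mult y xs) * ∏mult! xs)
    ≡⟨ *-exchange (suc (mult x xs)) (suc (mult y xs)) (∏mult! xs) ⟩
  suc (mult y xs) * (suc (mult x xs) * ∏mult! xs)
    ≡⟨ cong₂ (λ m r → suc m * r) (trans (count-↭ (y ≟_) xs↭ys) (sym (count-reject (y ≟_) (x≢y ∘ sym))))
         (cong₂ (λ m r → suc m * r) (count-↭ (x ≟_) xs↭ys) (∏mult!-↭ xs↭ys)) ⟩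
  suc (mult y (x ∷ ys)) * (suc (mult x ys) * ∏mult! ys) ∎
  where open ≡-Reasoning

∏mult!-remove : ∀ {v xs ys} → xs ↭ v ∷ ys → ∏mult! xs ≡ mult v xs * ∏mult! ys
∏mult!-remove {v} {xs} {ys} xs↭v∷ys = trans (∏mult!-↭ xs↭v∷ys)
  (cong (_* ∏mult! ys) (sym (trans (count-↭ (v ≟_) xs↭v∷ys) (mult-self v ys))))

multFactorials-suc : ∀ K β → multFactorials (suc K) β ≡ multFactorials K β * mult (suc K) β !
multFactorials-suc K β = begin
  product (map g (upTo (suc K)))      ≡⟨ cong (product ∘ map g) (upTo-∷ʳ K) ⟨
  product (map g (upTo K ∷ʳ K))       ≡⟨ cong product (map-++ g (upTo K) [ K ]) ⟩
  product (map g (upTo K) ++ [ g K ]) ≡⟨ product-++ (map g (upTo K)) [ g K ] ⟩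
  multFactorials K β * (g K * 1)      ≡⟨ cong (multFactorials K β *_) (*-identityʳ (g K)) ⟩
  multFactorials K β * g K            ∎
  where
  open ≡-Reasoning
  g = λ v → mult (suc v) β !

multFactorials-[] : ∀ K → multFactorials K [] ≡ 1
multFactorials-[] zero    = refl
multFactorials-[] (suc K) = trans (multFactorials-suc K []) (cong (_* 1) (multFactorials-[] K))

multFactorials-∷-above : ∀ K x β → K < x → multFactorials K (x ∷ β) ≡ multFactorials K β
multFactorials-∷-above zero    x β _   = refl
multFactorials-∷-above (suc K) x β K<x = begin
  multFactorials (suc K) (x ∷ β)                    ≡⟨ multFactorials-suc K (x ∷ β) ⟩
  multFactorials K (x ∷ β) * mult (suc K) (x ∷ β) !
    ≡⟨ cong₂ (λ m c → m * c !) (multFactorials-∷-above K x β (<⇒≤ K<x)) (count-reject (suc K ≟_) (<⇒≢ K<x)) ⟩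
  multFactorials K β * mult (suc K) β !             ≡⟨ multFactorials-suc K β ⟨
  multFactorials (suc K) β                          ∎
  where open ≡-Reasoning

multFactorials-∷ : ∀ K x β → 1 ≤ x → x ≤ K → multFactorials K (x ∷ β) ≡ suc (mult x β) * multFactorials K β
multFactorials-∷ zero    x β (s≤s _) ()
multFactorials-∷ (suc K) x β 1≤x x≤1+K with x ≟ suc K
... | yes refl = begin
  multFactorials (suc K) (x ∷ β)                     ≡⟨ multFactorials-suc K (x ∷ β) ⟩
  multFactorials K (x ∷ β) * mult x (x ∷ β) !
    ≡⟨ cong₂ (λ m c → m * c !) (multFactorials-∷-above K x β ≤-refl) (mult-self x β) ⟩
  multFactorials K β * (suc (mult x β) * mult x β !) ≡⟨ *-exchange (multFactorials K β) (suc (mult x β)) _ ⟩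
  suc (mult x β) * (multFactorials K β * mult x β !) ≡⟨ cong (suc (mult x β) *_) (multFactorials-suc K β) ⟨
  suc (mult x β) * multFactorials (suc K) β          ∎
  where open ≡-Reasoning
... | no x≢1+K = begin
  multFactorials (suc K) (x ∷ β)                     ≡⟨ multFactorials-suc K (x ∷ β) ⟩
  multFactorials K (x ∷ β) * mult (suc K) (x ∷ β) !
    ≡⟨ cong₂ (λ m c → m * c !) (multFactorials-∷ K x β 1≤x (≤-pred (≤∧≢⇒< x≤1+K x≢1+K)))
                               (count-reject (suc K ≟_) (x≢1+K ∘ sym)) ⟩
  suc (mult x β) * multFactorials K β * mult (suc K) β !
    ≡⟨ *-assoc (suc (mult x β)) (multFactorials K β) _ ⟩
  suc (mult x β) * (multFactorials K β * mult (suc K) β !)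
    ≡⟨ cong (suc (mult x β) *_) (multFactorials-suc K β) ⟨
  suc (mult x β) * multFactorials (suc K) β          ∎
  where open ≡-Reasoning

multFactorials≡∏mult! : ∀ K β → All (1 ≤_) β → All (_≤ K) β → multFactorials K β ≡ ∏mult! β
multFactorials≡∏mult! K []      []          []          = multFactorials-[] K
multFactorials≡∏mult! K (x ∷ β) (1≤x ∷ pos) (x≤K ∷ β≤K) =
  trans (multFactorials-∷ K x β 1≤x x≤K) (cong (suc (mult x β) *_) (multFactorials≡∏mult! K β pos β≤K))

count-<-suc : ∀ c xs → count (c <?_) xs ≡ mult (suc c) xs + count (suc c <?_) xs
count-<-suc c []       = refl
count-<-suc c (x ∷ xs) = split (suc c ≟ x) (c <? x)
  where
  ih = count-<-suc c xs
  split : Dec (suc c ≡ x) → Dec (c < x) →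
          count (c <?_) (x ∷ xs) ≡ mult (suc c) (x ∷ xs) + count (suc c <?_) (x ∷ xs)
  split (yes refl) _ = trans (count-accept (c <?_) ≤-refl) (trans (cong suc ih)
    (sym (cong₂ _+_ (mult-self (suc c) xs) (count-reject (suc c <?_) (n≮n (suc c))))))
  split (no 1+c≢x) (yes c<x) = trans (count-accept (c <?_) c<x) (trans (cong suc ih)
    (sym (trans (cong₂ _+_ (count-reject (suc c ≟_) 1+c≢x) (count-accept (suc c <?_) (≤∧≢⇒< c<x 1+c≢x)))
                (+-suc _ _))))
  split (no 1+c≢x) (no c≮x) = trans (count-reject (c <?_) c≮x) (trans ih
    (sym (cong₂ _+_ (count-reject (suc c ≟_) 1+c≢x) (count-reject (suc c <?_) (c≮x ∘ <⇒≤)))))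

sum-map-∸-suc : ∀ c xs → sum (map (_∸ c) xs) ≡ count (c <?_) xs + sum (map (_∸ suc c) xs)
sum-map-∸-suc c []       = refl
sum-map-∸-suc c (x ∷ xs) = split (c <? x)
  where
  C = count (c <?_) xs
  S = sum (map (_∸ suc c) xs)
  ih = sum-map-∸-suc c xs
  split : Dec (c < x) → sum (map (_∸ c) (x ∷ xs)) ≡ count (c <?_) (x ∷ xs) + sum (map (_∸ suc c) (x ∷ xs))
  split (yes c<x) = begin
    x ∸ c + sum (map (_∸ c) xs)              ≡⟨ cong₂ _+_ (+-∸-assoc 1 c<x) ih ⟩
    suc (x ∸ suc c) + (C + S)                ≡⟨ cong suc (+-exchange (x ∸ suc c) C S) ⟩
    suc C + (x ∸ suc c + S)                  ≡⟨ cong (_+ (x ∸ suc c + S)) (count-accept (c <?_) c<x) ⟨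
    count (c <?_) (x ∷ xs) + (x ∸ suc c + S) ∎
    where open ≡-Reasoning
  split (no c≮x) = begin
    x ∸ c + sum (map (_∸ c) xs)              ≡⟨ cong₂ _+_ (m≤n⇒m∸n≡0 x≤c) ih ⟩
    C + S
      ≡⟨ cong₂ _+_ (count-reject (c <?_) c≮x) (cong (_+ S) (m≤n⇒m∸n≡0 (m≤n⇒m≤1+n x≤c))) ⟨
    count (c <?_) (x ∷ xs) + (x ∸ suc c + S) ∎
    where
    open ≡-Reasoning
    x≤c = ≮⇒≥ c≮x

All-≤-sum : ∀ xs → All (_≤ sum xs) xs
All-≤-sum []       = []
All-≤-sum (x ∷ xs) = m≤m+n x (sum xs) ∷ All.map (λ y≤ → ≤-trans y≤ (m≤n+m (sum xs) x)) (All-≤-sum xs)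

All-≤-sum-≤ : ∀ {xs m} → sum xs ≤ m → All (_≤ m) xs
All-≤-sum-≤ {xs} sum≤m = All.map (λ x≤ → ≤-trans x≤ sum≤m) (All-≤-sum xs)

count-<-bounded : ∀ {c xs} → All (_≤ c) xs → count (c <?_) xs ≡ 0
count-<-bounded {c} xs≤c = count-none (c <?_) (All.map (λ x≤c c<x → <⇒≱ c<x x≤c) xs≤c)

sum-map-∸-bounded : ∀ {c xs} → All (_≤ c) xs → sum (map (_∸ c) xs) ≡ 0
sum-map-∸-bounded []           = refl
sum-map-∸-bounded (x≤c ∷ xs≤c) = cong₂ _+_ (m≤n⇒m∸n≡0 x≤c) (sum-map-∸-bounded xs≤c)

∑-mult : ∀ N c xs → All (_≤ N + c) xs → ∑[ e < N ] mult (toℕ e + suc c) xs ≡ count (c <?_) xs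
∑-mult zero    c xs xs≤c = sym (count-<-bounded xs≤c)
∑-mult (suc N) c xs xs≤  = begin
  mult (suc c) xs + ∑[ e < N ] mult (suc (toℕ e) + suc c) xs
    ≡⟨ cong (mult (suc c) xs +_) (sum-cong-≗ {N} λ e → cong (λ v → mult v xs) (+-suc (toℕ e) (suc c))) ⟨
  mult (suc c) xs + ∑[ e < N ] mult (toℕ e + suc (suc c)) xs
    ≡⟨ cong (mult (suc c) xs +_) (∑-mult N (suc c) xs (subst (λ m → All (_≤ m) xs) (sym (+-suc N c)) xs≤)) ⟩
  mult (suc c) xs + count (suc c <?_) xs
    ≡⟨ count-<-suc c xs ⟨
  count (c <?_) xs ∎
  where open ≡-Reasoning

-- Let w ⊆ {1,…,n} be preceded by c further non-members.  jumps c w lists the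
-- distances between consecutive members, the first one measured from
-- position 0 (so it is c + i₁), and trailing c w counts the non-members after
-- the last member (all c + n positions if there is none).  Thus cyclicGaps 0 w
-- are the gaps of w read cyclically in ℤ/n, the wrap-around gap listed first.
jumps : ℕ → ∀ {n} → Subset n → List ℕ
jumps c []          = []
jumps c (true  ∷ w) = suc c ∷ jumps 0 w
jumps c (false ∷ w) = jumps (suc c) w

trailing : ℕ → ∀ {n} → Subset n → ℕ
trailing c []          = c
trailing c (true  ∷ w) = trailing 0 w
trailing c (false ∷ w) = trailing (suc c) w

wrap : ℕ → List ℕ → List ℕ
wrap t []       = []
wrap t (j ∷ js) = t + j ∷ js

cyclicGaps : ℕ → ∀ {n} → Subset n → List ℕ
cyclicGaps c w = wrap (trailing c w) (jumps c w)

trailing-≤ : ∀ c {n} (w : Subset n) → trailing c w ≤ c + n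
trailing-≤ c []                  = ≤-reflexive (sym (+-identityʳ c))
trailing-≤ c (true  ∷ w)         = ≤-trans (trailing-≤ 0 w) (≤-trans (n≤1+n _) (m≤n+m _ c))
trailing-≤ c {suc n} (false ∷ w) = subst (trailing (suc c) w ≤_) (sym (+-suc c n)) (trailing-≤ (suc c) w)

arrangement? : ∀ c e μ {n} (w : Subset n) → Dec (trailing c w ≡ e × jumps c w ↭ μ)
arrangement? c e μ w = (trailing c w ≟ e) ×-dec (jumps c w ↭? μ)

headedArrangement? : ∀ v e μ {n} (w : Subset n) → Dec (trailing 0 w ≡ e × v ∷ jumps 0 w ↭ μ)
headedArrangement? v e μ w = (trailing 0 w ≟ e) ×-dec (v ∷ jumps 0 w ↭? μ)

arrangements : ℕ → ℕ → (n : ℕ) → List ℕ → ℕ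
arrangements c e n μ = count (arrangement? c e μ) (allSubsets n)

headedArrangements : ℕ → ℕ → (n : ℕ) → List ℕ → ℕ
headedArrangements v e n μ = count (headedArrangement? v e μ) (allSubsets n)

arrangements-[] : ∀ c e n → c + n ≡ e → arrangements c e n [] ≡ 1
arrangements-[] c e zero    c+0≡e =
  count-accept (arrangement? c e []) {[]} {[]} (trans (sym (+-identityʳ c)) c+0≡e , ↭.refl)
arrangements-[] c e (suc n) c+n≡e = begin
  arrangements c e (suc n) []
    ≡⟨ count-allSubsets-suc n (arrangement? c e []) ⟩
  headedArrangements (suc c) e n [] + arrangements (suc c) e n []
    ≡⟨ cong₂ _+_ (count-∅ (headedArrangement? (suc c) e []) (λ _ → ¬x∷xs↭[] ∘ proj₂) (allSubsets n))
                 (arrangements-[] (suc c) e n (trans (sym (+-suc c n)) c+n≡e)) ⟩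
  1 ∎
  where open ≡-Reasoning

mutual
  arrangements-∏mult! : ∀ n e μ → sum μ + e ≡ n → All (1 ≤_) μ →
    arrangements 0 e n μ * ∏mult! μ ≡ length μ !
  arrangements-∏mult! n e []      e≡n _   = cong (_* 1) (arrangements-[] 0 e n (sym e≡n))
  arrangements-∏mult! n e (x ∷ μ) eq  pos = begin
    arrangements 0 e n (x ∷ μ) * ∏mult! (x ∷ μ)
      ≡⟨ arrangements-∷-∏mult! n 0 e x μ (trans eq (sym (+-identityʳ n))) pos ⟩
    count (0 <?_) (x ∷ μ) * length μ !
      ≡⟨ cong (_* length μ !) (count-all (0 <?_) pos) ⟩
    length (x ∷ μ) ! ∎
    where open ≡-Reasoning

  arrangements-∷-∏mult! : ∀ n c e x μ → sum (x ∷ μ) + e ≡ n + c → All (1 ≤_) (x ∷ μ) →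
    arrangements c e n (x ∷ μ) * ∏mult! (x ∷ μ) ≡ count (c <?_) (x ∷ μ) * length μ !
  arrangements-∷-∏mult! zero c e x μ eq pos = begin
    arrangements c e 0 (x ∷ μ) * ∏mult! (x ∷ μ)
      ≡⟨ cong (_* ∏mult! (x ∷ μ)) (count-∅ (arrangement? c e (x ∷ μ)) (λ { [] (_ , p) → ¬x∷xs↭[] (↭-sym p) }) (allSubsets 0)) ⟩
    0
      ≡⟨ cong (_* length μ !) (count-<-bounded (All-≤-sum-≤ {x ∷ μ} (≤-trans (m≤m+n _ e) (≤-reflexive eq)))) ⟨
    count (c <?_) (x ∷ μ) * length μ ! ∎
    where open ≡-Reasoning
  arrangements-∷-∏mult! (suc n) c e x μ eq pos = begin
    arrangements c e (suc n) μ′ * ∏mult! μ′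
      ≡⟨ cong (_* ∏mult! μ′) (count-allSubsets-suc n (arrangement? c e μ′)) ⟩
    (headedArrangements (suc c) e n μ′ + arrangements (suc c) e n μ′) * ∏mult! μ′
      ≡⟨ *-distribʳ-+ (∏mult! μ′) (headedArrangements (suc c) e n μ′) _ ⟩
    headedArrangements (suc c) e n μ′ * ∏mult! μ′ + arrangements (suc c) e n μ′ * ∏mult! μ′
      ≡⟨ cong₂ _+_ (headedArrangements-∏mult! n e (suc c) μ′ (trans eq (cong suc (+-comm n c))) pos)
                   (arrangements-∷-∏mult! n (suc c) e x μ (trans eq (sym (+-suc n c))) pos) ⟩
    mult (suc c) μ′ * length μ ! + count (suc c <?_) μ′ * length μ !
      ≡⟨ *-distribʳ-+ (length μ !) (mult (suc c) μ′) _ ⟨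
    (mult (suc c) μ′ + count (suc c <?_) μ′) * length μ !
      ≡⟨ cong (_* length μ !) (count-<-suc c μ′) ⟨
    count (c <?_) μ′ * length μ ! ∎
    where
    open ≡-Reasoning
    μ′ = x ∷ μ

  headedArrangements-∏mult! : ∀ n e v μ → sum μ + e ≡ v + n → All (1 ≤_) μ →
    headedArrangements v e n μ * ∏mult! μ ≡ mult v μ * (length μ ∸ 1) !
  headedArrangements-∏mult! n e v μ eq pos = by-membership (v ∈? μ)
    where
    open ≡-Reasoning
    goal = headedArrangements v e n μ * ∏mult! μ ≡ mult v μ * (length μ ∸ 1) !

    removing : ∀ {μ′} → μ ↭ v ∷ μ′ → goal
    removing {μ′} μ↭v∷μ′ = begin
      headedArrangements v e n μ * ∏mult! μ
        ≡⟨ cong₂ _*_ (count-≐ (headedArrangement? v e μ) (arrangement? 0 e μ′) drop-head (allSubsets n))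
                     (∏mult!-remove μ↭v∷μ′) ⟩
      arrangements 0 e n μ′ * (mult v μ * ∏mult! μ′)
        ≡⟨ *-exchange (arrangements 0 e n μ′) (mult v μ) (∏mult! μ′) ⟩
      mult v μ * (arrangements 0 e n μ′ * ∏mult! μ′)
        ≡⟨ cong (mult v μ *_) (arrangements-∏mult! n e μ′ sum-μ′ (All.tail (All-resp-↭ μ↭v∷μ′ pos))) ⟩
      mult v μ * length μ′ !
        ≡⟨ cong (λ l → mult v μ * (l ∸ 1) !) (↭-length μ↭v∷μ′) ⟨
      mult v μ * (length μ ∸ 1) ! ∎
      where
      drop-head : (λ w → trailing 0 w ≡ e × v ∷ jumps 0 w ↭ μ) ≐ (λ w → trailing 0 w ≡ e × jumps 0 w ↭ μ′)
      drop-head = (λ (t , p) → t , drop-∷ (↭-trans p μ↭v∷μ′))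
                , (λ (t , q) → t , ↭-trans (↭.prep v q) (↭-sym μ↭v∷μ′))
      sum-μ′ : sum μ′ + e ≡ n
      sum-μ′ = +-cancelˡ-≡ v _ _
        (trans (sym (+-assoc v (sum μ′) e)) (trans (cong (_+ e) (sym (sum-↭ μ↭v∷μ′))) eq))

    by-membership : Dec (v ∈ μ) → goal
    by-membership (yes v∈μ) = removing (proj₂ (∈⇒↭∷ v∈μ))
    by-membership (no v∉μ)  = begin
      headedArrangements v e n μ * ∏mult! μ
        ≡⟨ cong (_* ∏mult! μ) (count-∅ (headedArrangement? v e μ)
             (λ _ (_ , v∷js↭μ) → v∉μ (∈-resp-↭ v∷js↭μ (here refl))) (allSubsets n)) ⟩
      0
        ≡⟨ cong (_* (length μ ∸ 1) !) (mult-∉ v∉μ) ⟨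
      mult v μ * (length μ ∸ 1) ! ∎

cyclicGaps? : ∀ c β {n} (w : Subset n) → Dec (cyclicGaps c w ↭ β)
cyclicGaps? c β w = cyclicGaps c w ↭? β

cyclicCount : ℕ → (n : ℕ) → List ℕ → ℕ
cyclicCount c n β = count (cyclicGaps? c β) (allSubsets n)

memberFirst-∏mult! : ∀ n c β → sum β ≡ suc n + c → All (1 ≤_) β →
  count (cyclicGaps? c β ∘ (true ∷_)) (allSubsets n) * ∏mult! β ≡ count (c <?_) β * (length β ∸ 1) !
memberFirst-∏mult! n c β eq pos = begin
  count Q? (allSubsets n) * ∏mult! β
    ≡⟨ cong (_* ∏mult! β) (count-fibres Q? (trailing 0) (λ w → s≤s (trailing-≤ 0 w)) (allSubsets n)) ⟩
  (∑[ e < suc n ] count (Q?∩trailing≡ e) (allSubsets n)) * ∏mult! β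
    ≡⟨ *-distribʳ-sum {suc n} (∏mult! β) (λ e → count (Q?∩trailing≡ e) (allSubsets n)) ⟩
  ∑[ e < suc n ] (count (Q?∩trailing≡ e) (allSubsets n) * ∏mult! β)
    ≡⟨ sum-cong-≗ {suc n} (λ e → cong (_* ∏mult! β) (count-≐ (Q?∩trailing≡ e)
         (headedArrangement? (toℕ e + suc c) (toℕ e) β) (fibre (toℕ e)) (allSubsets n))) ⟩
  ∑[ e < suc n ] (headedArrangements (toℕ e + suc c) (toℕ e) n β * ∏mult! β)
    ≡⟨ sum-cong-≗ {suc n} (λ e → headedArrangements-∏mult! n (toℕ e) (toℕ e + suc c) β (sum+e (toℕ e)) pos) ⟩
  ∑[ e < suc n ] (mult (toℕ e + suc c) β * K)
    ≡⟨ *-distribʳ-sum {suc n} K (λ e → mult (toℕ e + suc c) β) ⟨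
  (∑[ e < suc n ] mult (toℕ e + suc c) β) * K
    ≡⟨ cong (_* K) (∑-mult (suc n) c β (All-≤-sum-≤ (≤-reflexive eq))) ⟩
  count (c <?_) β * K ∎
  where
  open ≡-Reasoning
  K = (length β ∸ 1) !
  Q? = cyclicGaps? c β ∘ (true ∷_)
  Q?∩trailing≡ : ∀ e (w : Subset n) → Dec (cyclicGaps c (true ∷ w) ↭ β × trailing 0 w ≡ toℕ e)
  Q?∩trailing≡ e = Q? ∩? (λ w → trailing 0 w ≟ toℕ e)
  -- With trailing length e, the wrap-around gap of true ∷ w is e + c + 1.
  fibre : ∀ e → (λ w → (trailing 0 w + suc c) ∷ jumps 0 w ↭ β × trailing 0 w ≡ e)
              ≐ (λ w → trailing 0 w ≡ e × (e + suc c) ∷ jumps 0 w ↭ β)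
  fibre e = (λ { (p , refl) → refl , p }) , (λ { (refl , p) → p , refl })
  sum+e : ∀ e → sum β + e ≡ (e + suc c) + n
  sum+e e = trans (cong (_+ e) eq) (rearrange n c e)
    where
    rearrange : ∀ n c e → suc n + c + e ≡ (e + suc c) + n
    rearrange = solve-∀

cyclicCount-∏mult! : ∀ n c x β → sum (x ∷ β) ≡ n + c → All (1 ≤_) (x ∷ β) →
  cyclicCount c n (x ∷ β) * ∏mult! (x ∷ β) ≡ sum (map (_∸ c) (x ∷ β)) * length β !
cyclicCount-∏mult! zero c x β eq pos = begin
  cyclicCount c 0 (x ∷ β) * ∏mult! (x ∷ β)
    ≡⟨ cong (_* ∏mult! (x ∷ β)) (count-∅ (cyclicGaps? c (x ∷ β)) (λ { [] → ¬x∷xs↭[] ∘ ↭-sym }) (allSubsets 0)) ⟩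
  0
    ≡⟨ cong (_* length β !) (sum-map-∸-bounded (All-≤-sum-≤ {x ∷ β} (≤-reflexive eq))) ⟨
  sum (map (_∸ c) (x ∷ β)) * length β ! ∎
  where open ≡-Reasoning
cyclicCount-∏mult! (suc n) c x β eq pos = begin
  cyclicCount c (suc n) β′ * ∏mult! β′
    ≡⟨ cong (_* ∏mult! β′) (count-allSubsets-suc n (cyclicGaps? c β′)) ⟩
  (F + cyclicCount (suc c) n β′) * ∏mult! β′
    ≡⟨ *-distribʳ-+ (∏mult! β′) F _ ⟩
  F * ∏mult! β′ + cyclicCount (suc c) n β′ * ∏mult! β′
    ≡⟨ cong₂ _+_ (memberFirst-∏mult! n c β′ eq pos)
                 (cyclicCount-∏mult! n (suc c) x β (trans eq (sym (+-suc n c))) pos) ⟩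
  count (c <?_) β′ * length β ! + sum (map (_∸ suc c) β′) * length β !
    ≡⟨ *-distribʳ-+ (length β !) (count (c <?_) β′) _ ⟨
  (count (c <?_) β′ + sum (map (_∸ suc c) β′)) * length β !
    ≡⟨ cong (_* length β !) (sum-map-∸-suc c β′) ⟨
  sum (map (_∸ c) β′) * length β ! ∎
  where
  open ≡-Reasoning
  β′ = x ∷ β
  F = count (cyclicGaps? c β′ ∘ (true ∷_)) (allSubsets n)

∣∣≡length-jumps : ∀ c {n} (w : Subset n) → ∣ w ∣ ≡ length (jumps c w)
∣∣≡length-jumps c []          = refl
∣∣≡length-jumps c (true  ∷ w) = cong suc (∣∣≡length-jumps 0 w)
∣∣≡length-jumps c (false ∷ w) = ∣∣≡length-jumps (suc c) w

length-wrap : ∀ t js → length (wrap t js) ≡ length js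
length-wrap t []      = refl
length-wrap t (_ ∷ _) = refl

gaps-map-suc : ∀ is → gaps (map suc is) ≡ gaps is
gaps-map-suc []           = refl
gaps-map-suc (_ ∷ [])     = refl
gaps-map-suc (i ∷ j ∷ is) = cong (j ∸ i ∷_) (gaps-map-suc (j ∷ is))

lastOr0≡fromMaybe : ∀ is → lastOr0 is ≡ fromMaybe 0 (last is)
lastOr0≡fromMaybe is with last is
... | just _  = refl
... | nothing = refl

lastOr0-∷∷ : ∀ i j is → lastOr0 (i ∷ j ∷ is) ≡ lastOr0 (j ∷ is)
lastOr0-∷∷ i j is = trans (lastOr0≡fromMaybe (i ∷ j ∷ is)) (sym (lastOr0≡fromMaybe (j ∷ is)))

lastOr0-map-suc : ∀ i is → lastOr0 (map suc (i ∷ is)) ≡ suc (lastOr0 (i ∷ is))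
lastOr0-map-suc i []       = refl
lastOr0-map-suc i (j ∷ is) = begin
  lastOr0 (suc i ∷ suc j ∷ map suc is) ≡⟨ lastOr0-∷∷ (suc i) (suc j) (map suc is) ⟩
  lastOr0 (map suc (j ∷ is))           ≡⟨ lastOr0-map-suc j is ⟩
  suc (lastOr0 (j ∷ is))               ≡⟨ cong suc (lastOr0-∷∷ i j is) ⟨
  suc (lastOr0 (i ∷ j ∷ is))           ∎
  where open ≡-Reasoning

data IndicesView (c : ℕ) {n} (w : Subset n) : Set where
  no-members : indices w ≡ [] → jumps c w ≡ [] → trailing c w ≡ c + n → IndicesView c w
  members    : ∀ i is → indices w ≡ i ∷ is → 1 ≤ i → jumps c w ≡ c + i ∷ gaps (i ∷ is) →
               trailing c w ≡ n ∸ lastOr0 (i ∷ is) → IndicesView c w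

indicesView : ∀ c {n} (w : Subset n) → IndicesView c w
indicesView c [] = no-members refl refl (sym (+-identityʳ c))
indicesView c (true ∷ w) with indicesView 0 w
... | no-members eI ej et = members 1 [] (cong (λ is → 1 ∷ map suc is) eI) ≤-refl
        (cong₂ _∷_ (+-comm 1 c) ej) et
... | members j js eI _ ej et = members 1 (suc j ∷ map suc js) (cong (λ is → 1 ∷ map suc is) eI) ≤-refl
        (cong₂ _∷_ (+-comm 1 c) (trans ej (cong (j ∷_) (sym (gaps-map-suc (j ∷ js))))))
        (trans et (cong (_ ∸_) (sym (trans (lastOr0-∷∷ 1 (suc j) (map suc js)) (lastOr0-map-suc j js)))))
indicesView c {suc n} (false ∷ w) with indicesView (suc c) w
... | no-members eI ej et = no-members (cong (map suc) eI) ej (trans et (sym (+-suc c n)))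
... | members j js eI _ ej et = members (suc j) (map suc js) (cong (map suc) eI) (s≤s z≤n)
        (trans ej (cong₂ _∷_ (sym (+-suc c j)) (sym (gaps-map-suc (j ∷ js)))))
        (trans et (cong (suc n ∸_) (sym (lastOr0-map-suc j js))))

lam-↭-cyclicGaps : ∀ {k} (G : Subset k) → 0 < ∣ G ∣ → lam k G ↭ cyclicGaps 0 G
lam-↭-cyclicGaps {k} G 0<∣G∣ with indicesView 0 G
... | no-members _ ej _ = contradiction (trans (∣∣≡length-jumps 0 G) (cong length ej)) (>⇒≢ 0<∣G∣)
... | members i is eI 1≤i ej et = begin
  lam k G
    ≡⟨ cong (λ I → k ∸ lastOr0 I + (headOr0 I ∸ 1) + 1 ∷ reverse (gaps I)) eI ⟩
  k ∸ L + (i ∸ 1) + 1 ∷ reverse (gaps (i ∷ is))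
    ≡⟨ cong (_∷ reverse (gaps (i ∷ is))) (trans (+-assoc (k ∸ L) (i ∸ 1) 1) (cong (k ∸ L +_) (m∸n+n≡m 1≤i))) ⟩
  k ∸ L + i ∷ reverse (gaps (i ∷ is))
    ↭⟨ ↭.prep _ (↭-reverse (gaps (i ∷ is))) ⟩
  k ∸ L + i ∷ gaps (i ∷ is)
    ≡⟨ cong₂ wrap et ej ⟨
  cyclicGaps 0 G ∎
  where
  open ↭.PermutationReasoning
  L = lastOr0 (i ∷ is)

numFaces≡cyclicCount : ∀ k s x β → length (x ∷ β) ≡ s → numFaces k s (x ∷ β) ≡ cyclicCount 0 k (x ∷ β)
numFaces≡cyclicCount k s x β len≡s = count-≐
  (λ G → (∣ G ∣ ≟ s) ×-dec ≡-dec _≟_ (sort (lam k G)) (sort (x ∷ β))) (cyclicGaps? 0 (x ∷ β))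
  ( (λ {G} (∣G∣≡s , eq) → ↭-trans (↭-sym (lam-↭-cyclicGaps G (nonempty ∣G∣≡s))) (sort-≡⇒↭ eq))
  , (λ {G} p → let ∣G∣≡s = trans (∣∣≡length-cyclicGaps G) (trans (↭-length p) len≡s) in
               ∣G∣≡s , ↭⇒sort-≡ (↭-trans (lam-↭-cyclicGaps G (nonempty ∣G∣≡s)) p)))
  (allSubsets k)
  where
  nonempty : ∀ {m} → m ≡ s → 0 < m
  nonempty refl = subst (0 <_) len≡s (s≤s z≤n)
  ∣∣≡length-cyclicGaps : (G : Subset k) → ∣ G ∣ ≡ length (cyclicGaps 0 G)
  ∣∣≡length-cyclicGaps G = trans (∣∣≡length-jumps 0 G) (sym (length-wrap (trailing 0 G) (jumps 0 G)))

-- The faces do not depend on q, and 2 ≤ k only excludes β = [].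
mainTheorem9 : (k q s : ℕ) → 2 ≤ k → 1 ≤ q →
    (β : List ℕ) → All (1 ≤_) β → sum β ≡ k → length β ≡ s →
    numFaces k s β * multFactorials k β ≡ k * (s ∸ 1) !
mainTheorem9 _ _ _ (s≤s (s≤s _)) _ [] _ () _
mainTheorem9 k _ s _ _ (x ∷ β) pos sum≡k len≡s = begin
  numFaces k s (x ∷ β) * multFactorials k (x ∷ β)
    ≡⟨ cong₂ _*_ (numFaces≡cyclicCount k s x β len≡s)
                 (multFactorials≡∏mult! k (x ∷ β) pos (All-≤-sum-≤ (≤-reflexive sum≡k))) ⟩
  cyclicCount 0 k (x ∷ β) * ∏mult! (x ∷ β)
    ≡⟨ cyclicCount-∏mult! k 0 x β (trans sum≡k (sym (+-identityʳ k))) pos ⟩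
  sum (map (_∸ 0) (x ∷ β)) * length β !
    ≡⟨ cong₂ (λ t l → t * (l ∸ 1) !) (trans (cong sum (map-id (x ∷ β))) sum≡k) len≡s ⟩
  k * (s ∸ 1) ! ∎
  where open ≡-Reasoning
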